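{- Let $G$ and $H$ be $n\times n$ weak Hadamard matrices that have the same first column $\mathbf{x}$, and suppose $\mathbf{x}$ is orthogonal to every other column of $G$ and to every other column of $H$. Let $X$ be the $n\times n$ matrix whose first column is $\mathbf{x}$ and all of whose other columns are zero. Then the $2n\times 2n$ block matrix $$P=\begin{bmatrix} H & X\\ X & -G\end{bmatrix}$$ is a weak Hadamard matrix. Furthermore, if $G$ and $H$ each have pairwise orthogonal columns, then so does $P$.
   Context: A weak Hadamard matrix is a real square matrix $P$ with all entries in $\{ -1,0,1\}$ such that $P^TP$ is tridiagonal. -}

module Defs where

open import Data.Nat using (ℕ; zero; suc; _+_; _≤_)
open import Data.Fin using (Fin; zero; suc; toℕ; splitAt)
open import Data.Integer using (ℤ; +_; -[1+_]; -_; _*_) renaming (_+_ to _+ℤ_)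
open import Data.Sum using (_⊎_; inj₁; inj₂)
open import Data.Product using (_×_)
open import Relation.Binary.PropositionalEquality using (_≡_; _≢_)

Matrix : ℕ → ℕ → Set
Matrix m n = Fin m → Fin n → ℤ

∑ : (n : ℕ) → (Fin n → ℤ) → ℤ
∑ zero    f = + 0
∑ (suc n) f = f zero +ℤ ∑ n (λ i → f (suc i))

transpose : ∀ {m n} → Matrix m n → Matrix n m
transpose A i j = A j i

_⊗_ : ∀ {m k n} → Matrix m k → Matrix k n → Matrix m n
_⊗_ {k = k} A B i j = ∑ k (λ l → A i l * B l j)

IsTernary : ℤ → Set
IsTernary x = (x ≡ -[1+ 0 ]) ⊎ (x ≡ + 0) ⊎ (x ≡ + 1)

IsTridiagonal : ∀ {n} → Matrix n n → Set
IsTridiagonal {n} M = (i j : Fin n) → (suc (suc (toℕ i)) ≤ toℕ j ⊎ suc (suc (toℕ j)) ≤ toℕ i) → M i j ≡ + 0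

IsWeakHadamard : ∀ {n} → Matrix n n → Set
IsWeakHadamard {n} P = ((i j : Fin n) → IsTernary (P i j)) × IsTridiagonal (transpose P ⊗ P)

colDot : ∀ {m n} → Matrix m n → Fin n → Fin n → ℤ
colDot {m} A i j = ∑ m (λ k → A k i * A k j)

PairwiseOrthogonalColumns : ∀ {m n} → Matrix m n → Set
PairwiseOrthogonalColumns {n = n} A = (i j : Fin n) → i ≢ j → colDot A i j ≡ + 0

negM : ∀ {m n} → Matrix m n → Matrix m n
negM A i j = - (A i j)

block : ∀ {m₁ m₂ n₁ n₂} → Matrix m₁ n₁ → Matrix m₁ n₂ → Matrix m₂ n₁ → Matrix m₂ n₂
      → Matrix (m₁ + m₂) (n₁ + n₂)
block {m₁} {m₂} {n₁} {n₂} A B C D i j with splitAt m₁ i | splitAt n₁ j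
... | inj₁ i' | inj₁ j' = A i' j'
... | inj₁ i' | inj₂ j' = B i' j'
... | inj₂ i' | inj₁ j' = C i' j'
... | inj₂ i' | inj₂ j' = D i' j'

firstColMatrix : ∀ {n} → (Fin (suc n) → ℤ) → Matrix (suc n) (suc n)
firstColMatrix x i zero    = x i
firstColMatrix x i (suc j) = + 0

{-# OPTIONS --safe #-}
module Submission where

-- The Gram matrix of P is [ HᵀH + XᵀX , HᵀX − XᵀG ; XᵀH − GᵀX , XᵀX + GᵀG ].  Since XᵀX vanishes
-- off its corner entry x·x, the diagonal blocks agree with HᵀH and GᵀG off the diagonal.  Since x is
-- the first column of H and orthogonal to its other columns, HᵀX = XᵀX; likewise GᵀX = XᵀX, so the
-- off-diagonal blocks vanish.  Any vanishing pattern of the Gram matrices of G and H that is stable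
-- under the block embeddings (being far apart, being distinct) is therefore inherited by P.

open import Defs
open import Data.Nat using (ℕ; zero; suc; _≤_; s≤s) renaming (_+_ to _+ℕ_)
open import Data.Nat.Properties using (+-suc; +-cancelˡ-≤)
open import Data.Fin using (Fin; zero; suc; toℕ; splitAt; _↑ˡ_; _↑ʳ_)
open import Data.Fin.Properties using (splitAt-↑ˡ; splitAt-↑ʳ; join-splitAt; toℕ-↑ˡ; toℕ-↑ʳ)
open import Data.Integer using (ℤ; +_; -_; _*_; _+_)
open import Data.Integer.Properties
  using (+-assoc; +-identityˡ; +-identityʳ; +-inverseʳ; *-zeroʳ; *-comm;
         neg-distribˡ-*; neg-distribʳ-*; neg-involutive; neg-distrib-+)
open import Data.Product using (_×_; _,_)
open import Data.Sum as Sum using (_⊎_; inj₁; inj₂)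
open import Data.Empty using (⊥)
open import Relation.Nullary using (contradiction)
open import Function using (_∘_; id)
open import Relation.Binary.PropositionalEquality
open ≡-Reasoning

∑-cong : ∀ n {f g : Fin n → ℤ} → (∀ k → f k ≡ g k) → ∑ n f ≡ ∑ n g
∑-cong zero    f≗g = refl
∑-cong (suc n) f≗g = cong₂ _+_ (f≗g zero) (∑-cong n (f≗g ∘ suc))

∑-zero : ∀ n {f : Fin n → ℤ} → (∀ k → f k ≡ + 0) → ∑ n f ≡ + 0
∑-zero zero    f≗0 = refl
∑-zero (suc n) f≗0 = cong₂ _+_ (f≗0 zero) (∑-zero n (f≗0 ∘ suc))

∑-neg : ∀ n (f : Fin n → ℤ) → ∑ n (λ k → - f k) ≡ - ∑ n f
∑-neg zero    f = refl
∑-neg (suc n) f = begin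
  - f zero + ∑ n (λ k → - f (suc k))  ≡⟨ cong (_+_ (- f zero)) (∑-neg n (f ∘ suc)) ⟩
  - f zero + - ∑ n (f ∘ suc)          ≡⟨ neg-distrib-+ (f zero) _ ⟨
  - ∑ (suc n) f                       ∎

∑-++ : ∀ m n (f : Fin (m +ℕ n) → ℤ) →
       ∑ (m +ℕ n) f ≡ ∑ m (λ k → f (k ↑ˡ n)) + ∑ n (λ k → f (m ↑ʳ k))
∑-++ zero    n f = sym (+-identityˡ _)
∑-++ (suc m) n f = begin
  f zero + ∑ (m +ℕ n) (f ∘ suc)                                        ≡⟨ cong (_+_ (f zero)) (∑-++ m n (f ∘ suc)) ⟩
  f zero + (∑ m (λ k → f (suc (k ↑ˡ n))) + ∑ n (λ k → f (suc m ↑ʳ k))) ≡⟨ +-assoc (f zero) _ _ ⟨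
  ∑ (suc m) (λ k → f (k ↑ˡ n)) + ∑ n (λ k → f (suc m ↑ʳ k))            ∎

neg-*-neg : ∀ a b → - a * - b ≡ a * b
neg-*-neg a b = begin
  - a * - b    ≡⟨ neg-distribˡ-* a (- b) ⟨
  - (a * - b)  ≡⟨ cong -_ (neg-distribʳ-* a b) ⟨
  - - (a * b)  ≡⟨ neg-involutive (a * b) ⟩
  a * b        ∎

IsTernary-neg : ∀ {z} → IsTernary z → IsTernary (- z)
IsTernary-neg (inj₁ refl)        = inj₂ (inj₂ refl)
IsTernary-neg (inj₂ (inj₁ refl)) = inj₂ (inj₁ refl)
IsTernary-neg (inj₂ (inj₂ refl)) = inj₁ refl

data SplitView (m n : ℕ) : Fin (m +ℕ n) → Set where
  left  : ∀ i → SplitView m n (i ↑ˡ n)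
  right : ∀ j → SplitView m n (m ↑ʳ j)

splitView : ∀ m n a → SplitView m n a
splitView m n a with splitAt m a | join-splitAt m n a
... | inj₁ i | refl = left i
... | inj₂ j | refl = right j

FarApart : ∀ {m} → Fin m → Fin m → Set
FarApart i j = suc (suc (toℕ i)) ≤ toℕ j ⊎ suc (suc (toℕ j)) ≤ toℕ i

FarApart⇒≢ : ∀ {m} {i j : Fin m} → FarApart i j → i ≢ j
FarApart⇒≢ {i = i} i≪j refl = Sum.[ 2+n≰n , 2+n≰n ] i≪j
  where
  2+n≰n : ∀ {n} → suc (suc n) ≤ n → ⊥
  2+n≰n {suc n} (s≤s p) = 2+n≰n p

FarApart-↑ˡ : ∀ {m} n {i j : Fin m} → FarApart (i ↑ˡ n) (j ↑ˡ n) → FarApart i j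
FarApart-↑ˡ n {i} {j} rewrite toℕ-↑ˡ i n | toℕ-↑ˡ j n = id

FarApart-↑ʳ : ∀ m {n} {i j : Fin n} → FarApart (m ↑ʳ i) (m ↑ʳ j) → FarApart i j
FarApart-↑ʳ m {i = i} {j} rewrite toℕ-↑ʳ m i | toℕ-↑ʳ m j = Sum.map cancel cancel
  where
  cancel : ∀ {a b} → suc (suc (m +ℕ a)) ≤ m +ℕ b → suc (suc a) ≤ b
  cancel {a} {b} p = +-cancelˡ-≤ m _ _ (subst (_≤ m +ℕ b) (sym m+2+a≡2+m+a) p)
    where
    m+2+a≡2+m+a : m +ℕ suc (suc a) ≡ suc (suc (m +ℕ a))
    m+2+a≡2+m+a = trans (+-suc m (suc a)) (cong suc (+-suc m a))

module _ {m₁ m₂ n₁ n₂} (A : Matrix m₁ n₁) (B : Matrix m₁ n₂) (C : Matrix m₂ n₁) (D : Matrix m₂ n₂) where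

  block-ˡˡ : ∀ i j → block A B C D (i ↑ˡ m₂) (j ↑ˡ n₂) ≡ A i j
  block-ˡˡ i j rewrite splitAt-↑ˡ m₁ i m₂ | splitAt-↑ˡ n₁ j n₂ = refl

  block-ˡʳ : ∀ i j → block A B C D (i ↑ˡ m₂) (n₁ ↑ʳ j) ≡ B i j
  block-ˡʳ i j rewrite splitAt-↑ˡ m₁ i m₂ | splitAt-↑ʳ n₁ n₂ j = refl

  block-ʳˡ : ∀ i j → block A B C D (m₁ ↑ʳ i) (j ↑ˡ n₂) ≡ C i j
  block-ʳˡ i j rewrite splitAt-↑ʳ m₁ m₂ i | splitAt-↑ˡ n₁ j n₂ = refl

  block-ʳʳ : ∀ i j → block A B C D (m₁ ↑ʳ i) (n₁ ↑ʳ j) ≡ D i j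
  block-ʳʳ i j rewrite splitAt-↑ʳ m₁ m₂ i | splitAt-↑ʳ n₁ n₂ j = refl

  block-entrywise : (Q : ℤ → Set) → (∀ i j → Q (A i j)) → (∀ i j → Q (B i j)) →
                    (∀ i j → Q (C i j)) → (∀ i j → Q (D i j)) → ∀ a b → Q (block A B C D a b)
  block-entrywise Q qA qB qC qD a b with splitView m₁ m₂ a | splitView n₁ n₂ b
  ... | left i  | left j  = subst Q (sym (block-ˡˡ i j)) (qA i j)
  ... | left i  | right j = subst Q (sym (block-ˡʳ i j)) (qB i j)
  ... | right i | left j  = subst Q (sym (block-ʳˡ i j)) (qC i j)
  ... | right i | right j = subst Q (sym (block-ʳʳ i j)) (qD i j)

  colDot-block-ˡˡ : ∀ i j → colDot (block A B C D) (i ↑ˡ n₂) (j ↑ˡ n₂) ≡ colDot A i j + colDot C i j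
  colDot-block-ˡˡ i j = trans (∑-++ m₁ m₂ _)
    (cong₂ _+_ (∑-cong m₁ λ k → cong₂ _*_ (block-ˡˡ k i) (block-ˡˡ k j))
               (∑-cong m₂ λ k → cong₂ _*_ (block-ʳˡ k i) (block-ʳˡ k j)))

  colDot-block-ʳʳ : ∀ i j → colDot (block A B C D) (n₁ ↑ʳ i) (n₁ ↑ʳ j) ≡ colDot B i j + colDot D i j
  colDot-block-ʳʳ i j = trans (∑-++ m₁ m₂ _)
    (cong₂ _+_ (∑-cong m₁ λ k → cong₂ _*_ (block-ˡʳ k i) (block-ˡʳ k j))
               (∑-cong m₂ λ k → cong₂ _*_ (block-ʳʳ k i) (block-ʳʳ k j)))

  colDot-block-ˡʳ : ∀ i j → colDot (block A B C D) (i ↑ˡ n₂) (n₁ ↑ʳ j)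
                            ≡ (transpose A ⊗ B) i j + (transpose C ⊗ D) i j
  colDot-block-ˡʳ i j = trans (∑-++ m₁ m₂ _)
    (cong₂ _+_ (∑-cong m₁ λ k → cong₂ _*_ (block-ˡˡ k i) (block-ˡʳ k j))
               (∑-cong m₂ λ k → cong₂ _*_ (block-ʳˡ k i) (block-ʳʳ k j)))

module _ {m n k : ℕ} where

  transpose-⊗-comm : (A : Matrix m n) (B : Matrix m k) → ∀ i j → (transpose A ⊗ B) i j ≡ (transpose B ⊗ A) j i
  transpose-⊗-comm A B i j = ∑-cong m λ l → *-comm (A l i) (B l j)

  transpose-⊗-negM : (A : Matrix m n) (B : Matrix m k) → ∀ i j → (transpose A ⊗ negM B) i j ≡ - (transpose A ⊗ B) i j
  transpose-⊗-negM A B i j = trans (∑-cong m λ l → sym (neg-distribʳ-* (A l i) (B l j))) (∑-neg m _)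

colDot-comm : ∀ {m n} (A : Matrix m n) i j → colDot A i j ≡ colDot A j i
colDot-comm A = transpose-⊗-comm A A

colDot-negM : ∀ {m n} (A : Matrix m n) i j → colDot (negM A) i j ≡ colDot A i j
colDot-negM {m} A i j = ∑-cong m λ k → neg-*-neg (A k i) (A k j)

module _ {n} (x : Fin (suc n) → ℤ) where

  private
    X = firstColMatrix x

  firstColMatrix-entrywise : (Q : ℤ → Set) → Q (+ 0) → (∀ i → Q (x i)) → ∀ i j → Q (X i j)
  firstColMatrix-entrywise Q q0 qx i zero    = qx i
  firstColMatrix-entrywise Q q0 qx i (suc j) = q0

  colDot-firstColMatrix-≢ : ∀ {i j} → i ≢ j → colDot X i j ≡ + 0
  colDot-firstColMatrix-≢ {zero}  {zero}  i≢j = contradiction refl i≢j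
  colDot-firstColMatrix-≢ {zero}  {suc j} _ = ∑-zero (suc n) λ k → *-zeroʳ (x k)
  colDot-firstColMatrix-≢ {suc i} {j}     _ = ∑-zero (suc n) λ k → refl

  transpose-⊗-firstColMatrix : (A : Matrix (suc n) (suc n)) → (∀ k → A k zero ≡ x k) →
    (∀ j → colDot A zero (suc j) ≡ + 0) → ∀ i j → (transpose A ⊗ X) i j ≡ colDot X i j
  transpose-⊗-firstColMatrix A x₀ x⊥ i       (suc j) = trans (∑-zero (suc n) λ k → *-zeroʳ (A k i))
                                                           (sym (∑-zero (suc n) λ k → *-zeroʳ (X k i)))
  transpose-⊗-firstColMatrix A x₀ x⊥ zero    zero    = ∑-cong (suc n) λ k → cong (_* x k) (x₀ k)
  transpose-⊗-firstColMatrix A x₀ x⊥ (suc i) zero    = begin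
    ∑ (suc n) (λ k → A k (suc i) * x k)      ≡⟨ ∑-cong (suc n) (λ k → cong (A k (suc i) *_) (sym (x₀ k))) ⟩
    colDot A (suc i) zero                    ≡⟨ colDot-comm A (suc i) zero ⟩
    colDot A zero (suc i)                    ≡⟨ x⊥ i ⟩
    + 0                                      ≡⟨ ∑-zero (suc n) (λ k → refl) ⟨
    colDot X (suc i) zero                    ∎

module Doubling {n} (G H : Matrix (suc n) (suc n)) (x : Fin (suc n) → ℤ)
  (G-col₀ : ∀ i → G i zero ≡ x i) (H-col₀ : ∀ i → H i zero ≡ x i)
  (x⊥G : ∀ j → colDot G zero (suc j) ≡ + 0) (x⊥H : ∀ j → colDot H zero (suc j) ≡ + 0) where

  N = suc n
  X = firstColMatrix x
  P = block H X X (negM G)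

  P-ternary : (∀ i j → IsTernary (G i j)) → (∀ i j → IsTernary (H i j)) → ∀ a b → IsTernary (P a b)
  P-ternary G±1 H±1 = block-entrywise H X X (negM G) IsTernary H±1 X±1 X±1 (λ i j → IsTernary-neg (G±1 i j))
    where
    X±1 = firstColMatrix-entrywise x IsTernary (inj₂ (inj₁ refl)) (λ i → subst IsTernary (H-col₀ i) (H±1 i zero))

  colDot-P-ˡˡ : ∀ {i j} → i ≢ j → colDot P (i ↑ˡ N) (j ↑ˡ N) ≡ colDot H i j
  colDot-P-ˡˡ {i} {j} i≢j = begin
    colDot P (i ↑ˡ N) (j ↑ˡ N)   ≡⟨ colDot-block-ˡˡ H X X (negM G) i j ⟩
    colDot H i j + colDot X i j  ≡⟨ cong (_+_ (colDot H i j)) (colDot-firstColMatrix-≢ x i≢j) ⟩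
    colDot H i j + + 0           ≡⟨ +-identityʳ _ ⟩
    colDot H i j                 ∎

  colDot-P-ʳʳ : ∀ {i j} → i ≢ j → colDot P (N ↑ʳ i) (N ↑ʳ j) ≡ colDot G i j
  colDot-P-ʳʳ {i} {j} i≢j = begin
    colDot P (N ↑ʳ i) (N ↑ʳ j)          ≡⟨ colDot-block-ʳʳ H X X (negM G) i j ⟩
    colDot X i j + colDot (negM G) i j  ≡⟨ cong₂ _+_ (colDot-firstColMatrix-≢ x i≢j) (colDot-negM G i j) ⟩
    + 0 + colDot G i j                  ≡⟨ +-identityˡ _ ⟩
    colDot G i j                        ∎

  colDot-P-ˡʳ : ∀ i j → colDot P (i ↑ˡ N) (N ↑ʳ j) ≡ + 0
  colDot-P-ˡʳ i j = begin
    colDot P (i ↑ˡ N) (N ↑ʳ j)                           ≡⟨ colDot-block-ˡʳ H X X (negM G) i j ⟩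
    (transpose H ⊗ X) i j + (transpose X ⊗ negM G) i j  ≡⟨ cong (_+_ ((transpose H ⊗ X) i j)) (transpose-⊗-negM X G i j) ⟩
    (transpose H ⊗ X) i j + - (transpose X ⊗ G) i j     ≡⟨ cong₂ (λ a b → a + - b) HᵀX≡XᵀX (transpose-⊗-comm X G i j) ⟩
    colDot X i j + - (transpose G ⊗ X) j i              ≡⟨ cong (λ b → colDot X i j + - b) GᵀX≡XᵀX ⟩
    colDot X i j + - colDot X i j                       ≡⟨ +-inverseʳ (colDot X i j) ⟩
    + 0                                                 ∎
    where
    HᵀX≡XᵀX = transpose-⊗-firstColMatrix x H H-col₀ x⊥H i j
    GᵀX≡XᵀX = trans (transpose-⊗-firstColMatrix x G G-col₀ x⊥G j i) (colDot-comm X j i)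

  colDot-P-vanishes : (R : ∀ {m} → Fin m → Fin m → Set) → (∀ {i j : Fin N} → R i j → i ≢ j) →
    (∀ {i j : Fin N} → R (i ↑ˡ N) (j ↑ˡ N) → R i j) → (∀ {i j : Fin N} → R (N ↑ʳ i) (N ↑ʳ j) → R i j) →
    (∀ i j → R i j → colDot H i j ≡ + 0) → (∀ i j → R i j → colDot G i j ≡ + 0) →
    ∀ a b → R a b → colDot P a b ≡ + 0
  colDot-P-vanishes R R⇒≢ R-↑ˡ R-↑ʳ H⊥ G⊥ a b Rab with splitView N N a | splitView N N b
  ... | left i  | left j  = trans (colDot-P-ˡˡ (R⇒≢ (R-↑ˡ Rab))) (H⊥ i j (R-↑ˡ Rab))
  ... | left i  | right j = colDot-P-ˡʳ i j
  ... | right i | left j  = trans (colDot-comm P (N ↑ʳ i) (j ↑ˡ N)) (colDot-P-ˡʳ j i)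
  ... | right i | right j = trans (colDot-P-ʳʳ (R⇒≢ (R-↑ʳ Rab))) (G⊥ i j (R-↑ʳ Rab))

proposition2p14 : (n : ℕ) (G H : Matrix (suc n) (suc n)) (x : Fin (suc n) → ℤ) →
    IsWeakHadamard G → IsWeakHadamard H →
    ((i : Fin (suc n)) → G i zero ≡ x i) → ((i : Fin (suc n)) → H i zero ≡ x i) →
    ((j : Fin n) → colDot G zero (suc j) ≡ + 0) → ((j : Fin n) → colDot H zero (suc j) ≡ + 0) →
    IsWeakHadamard (block H (firstColMatrix x) (firstColMatrix x) (negM G))
    × (PairwiseOrthogonalColumns G → PairwiseOrthogonalColumns H →
       PairwiseOrthogonalColumns (block H (firstColMatrix x) (firstColMatrix x) (negM G)))
proposition2p14 n G H x (G±1 , G-tridiagonal) (H±1 , H-tridiagonal) G-col₀ H-col₀ x⊥G x⊥H =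
  (P-ternary G±1 H±1 , P-tridiagonal) , P-orthogonal
  where
  open Doubling G H x G-col₀ H-col₀ x⊥G x⊥H

  P-tridiagonal : IsTridiagonal (transpose P ⊗ P)
  P-tridiagonal = colDot-P-vanishes FarApart FarApart⇒≢ (FarApart-↑ˡ N) (FarApart-↑ʳ N)
                                    H-tridiagonal G-tridiagonal

  P-orthogonal : PairwiseOrthogonalColumns G → PairwiseOrthogonalColumns H → PairwiseOrthogonalColumns P
  P-orthogonal G-orthogonal H-orthogonal =
    colDot-P-vanishes _≢_ id (λ i≢j → i≢j ∘ cong (_↑ˡ N)) (λ i≢j → i≢j ∘ cong (N ↑ʳ_))
                      H-orthogonal G-orthogonal
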